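{- Let $f(x)\in\mathbb{Z}[x]$ and $g(x)=x+a$ where $a$ is an integer. Let $t$ be an integer such that $n$ is the minimum positive integer for which $f^n(t)\in\operatorname{Orb}^{\pm}_g(t)$. Then for every integer $k\ge0$, $f^k(t)\in\operatorname{Orb}^{\pm}_g(t)$ if and only if $n\mid k$.
   Context: $f^0(x)=x$, $f^k=f\circ f^{k-1}$. For $g(x)=x+a$, $\operatorname{Orb}^{\pm}_g(t)=\{g^m(t):m\in\mathbb{Z}\}=\{t+ma: m\in\mathbb{Z}\}$. -}

module Defs where

open import Data.Nat using (ℕ; zero; suc)
open import Data.Integer using (ℤ; _+_; _*_; +_)
open import Data.List using (List; []; _∷_)
open import Data.Product using (∃-syntax)
open import Relation.Binary.PropositionalEquality using (_≡_)

-- A polynomial in ℤ[x] given by its coefficient list [c₀, c₁, …, c_d]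
-- (lowest degree first); evaluation by Horner's rule.
eval : List ℤ → ℤ → ℤ
eval []       x = + 0
eval (c ∷ cs) x = c + x * eval cs x

iter : (ℤ → ℤ) → ℕ → ℤ → ℤ
iter f zero    x = x
iter f (suc k) x = f (iter f k x)

-- Orb^±_g(t) for g(x) = x + a : { t + m a : m ∈ ℤ }
InOrb± : ℤ → ℤ → ℤ → Set
InOrb± a t y = ∃[ m ] y ≡ t + m * a

-- Being in the same ⟨g⟩-orbit, g(x) = x + a, is congruence modulo a, which every
-- integer polynomial f preserves. Hence the iterates of f descend to a map on the
-- orbits, and the times k at which f^k(t) returns to the orbit of t are exactly the
-- multiples of the first return time n: f^(r + q n)(t) lies in the orbit of f^r(t),
-- and for 0 < r < n that orbit is not the orbit of t.
module Submission where

open import Defs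
open import Data.Nat as ℕ using (ℕ; zero; suc; _<_; z<s; >-nonZero)
open import Data.Nat.DivMod using (_%_; _/_; m≡m%n+[m/n]*n; m%n<n)
open import Data.Nat.Divisibility using (_∣_; divides; m%n≡0⇒n∣m)
open import Data.Integer as ℤ using (ℤ; +_; -_)
open import Data.Integer.Tactic.RingSolver using (solve-∀)
open import Data.List using (List; []; _∷_)
open import Data.Product using (_,_)
open import Data.Empty using (⊥-elim)
open import Level using (Level)
open import Relation.Binary.Core using (Rel; _Preserves_⟶_)
open import Relation.Binary.Structures using (IsEquivalence)
open import Relation.Binary.PropositionalEquality
  using (_≡_; refl; sym; cong; subst)
open import Relation.Nullary using (¬_)
open import Function.Bundles using (_⇔_; mk⇔)

module Returns {ℓ : Level} {_∼_ : Rel ℤ ℓ} (∼-equiv : IsEquivalence _∼_)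
               (F : ℤ → ℤ) (F-cong : F Preserves _∼_ ⟶ _∼_) where

  open IsEquivalence ∼-equiv renaming (refl to ∼-refl; sym to ∼-sym; trans to ∼-trans)

  iter-cong : ∀ j → iter F j Preserves _∼_ ⟶ _∼_
  iter-cong zero    x∼y = x∼y
  iter-cong (suc j) x∼y = F-cong (iter-cong j x∼y)

  iter-+ : ∀ j m x → iter F (j ℕ.+ m) x ≡ iter F j (iter F m x)
  iter-+ zero    m x = refl
  iter-+ (suc j) m x = cong F (iter-+ j m x)

  module _ {n : ℕ} {t : ℤ} (return : iter F n t ∼ t) where

    returns-at-multiples : ∀ q → iter F (q ℕ.* n) t ∼ t
    returns-at-multiples zero    = ∼-refl
    returns-at-multiples (suc q) rewrite iter-+ n (q ℕ.* n) t =
      ∼-trans (iter-cong n (returns-at-multiples q)) return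

    iter-periodic : ∀ r q → iter F (r ℕ.+ q ℕ.* n) t ∼ iter F r t
    iter-periodic r q rewrite iter-+ r (q ℕ.* n) t =
      iter-cong r (returns-at-multiples q)

  returns⇔first-return∣ :
    ∀ {n t} → 0 < n → iter F n t ∼ t →
    (∀ m → 0 < m → m < n → ¬ iter F m t ∼ t) →
    ∀ k → (iter F k t ∼ t ⇔ n ∣ k)
  returns⇔first-return∣ {n} {t} 0<n return first k = mk⇔ to from
    where
    instance _ = >-nonZero 0<n

    from : n ∣ k → iter F k t ∼ t
    from (divides q refl) = returns-at-multiples return q

    remainder-returns : iter F k t ∼ t → iter F (k % n) t ∼ t
    remainder-returns k-returns = ∼-trans
      (∼-sym (subst (λ j → iter F j t ∼ iter F (k % n) t) (sym (m≡m%n+[m/n]*n k n))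
                    (iter-periodic return (k % n) (k / n))))
      k-returns

    to : iter F k t ∼ t → n ∣ k
    to k-returns with k % n in k%n≡r | remainder-returns k-returns
    ... | zero  | _         = m%n≡0⇒n∣m k n k%n≡r
    ... | suc r | r-returns =
      ⊥-elim (first (suc r) z<s (subst (_< n) k%n≡r (m%n<n k n)) r-returns)

SameOrbit : ℤ → Rel ℤ _
SameOrbit a x y = InOrb± a y x

sameOrbit-isEquivalence : ∀ a → IsEquivalence (SameOrbit a)
sameOrbit-isEquivalence a = record
  { refl  = λ {x} → + 0 , +0-identity x a
  ; sym   = λ { {y = y} (m , refl) → - m , ⁻-cancel y m a }
  ; trans = λ { {k = z} (m , refl) (m′ , refl) → m′ ℤ.+ m , +-merge z m m′ a }
  }
  where
  +0-identity : ∀ x a → x ≡ x ℤ.+ + 0 ℤ.* a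
  +0-identity = solve-∀
  ⁻-cancel : ∀ y m a → y ≡ (y ℤ.+ m ℤ.* a) ℤ.+ (- m) ℤ.* a
  ⁻-cancel = solve-∀
  +-merge : ∀ z m m′ a → (z ℤ.+ m′ ℤ.* a) ℤ.+ m ℤ.* a ≡ z ℤ.+ (m′ ℤ.+ m) ℤ.* a
  +-merge = solve-∀

sameOrbit-+ : ∀ {a x x′ y y′} → SameOrbit a x x′ → SameOrbit a y y′ →
              SameOrbit a (x ℤ.+ y) (x′ ℤ.+ y′)
sameOrbit-+ {a} {x′ = x′} {y′ = y′} (m , refl) (m′ , refl) =
  m ℤ.+ m′ , regroup x′ y′ m m′ a
  where
  regroup : ∀ x′ y′ m m′ a →
    (x′ ℤ.+ m ℤ.* a) ℤ.+ (y′ ℤ.+ m′ ℤ.* a) ≡ (x′ ℤ.+ y′) ℤ.+ (m ℤ.+ m′) ℤ.* a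
  regroup = solve-∀

sameOrbit-* : ∀ {a x x′ y y′} → SameOrbit a x x′ → SameOrbit a y y′ →
              SameOrbit a (x ℤ.* y) (x′ ℤ.* y′)
sameOrbit-* {a} {x′ = x′} {y′ = y′} (m , refl) (m′ , refl) =
  m ℤ.* y′ ℤ.+ x′ ℤ.* m′ ℤ.+ m ℤ.* m′ ℤ.* a , expand x′ y′ m m′ a
  where
  expand : ∀ x′ y′ m m′ a →
    (x′ ℤ.+ m ℤ.* a) ℤ.* (y′ ℤ.+ m′ ℤ.* a)
      ≡ x′ ℤ.* y′ ℤ.+ (m ℤ.* y′ ℤ.+ x′ ℤ.* m′ ℤ.+ m ℤ.* m′ ℤ.* a) ℤ.* a
  expand = solve-∀

eval-sameOrbit : ∀ a f → eval f Preserves SameOrbit a ⟶ SameOrbit a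
eval-sameOrbit a []       _   = IsEquivalence.refl (sameOrbit-isEquivalence a)
eval-sameOrbit a (c ∷ cs) {x} {y} x∼y =
  sameOrbit-+ {a} {c} {c} {x ℤ.* eval cs x} {y ℤ.* eval cs y}
    (IsEquivalence.refl (sameOrbit-isEquivalence a))
    (sameOrbit-* {a} {x} {y} {eval cs x} {eval cs y} x∼y (eval-sameOrbit a cs x∼y))

proposition2p6 : (f : List ℤ) (a t : ℤ) (n : ℕ) →
    0 < n →
    InOrb± a t (iter (eval f) n t) →
    ((m : ℕ) → 0 < m → m < n → ¬ InOrb± a t (iter (eval f) m t)) →
    (k : ℕ) → (InOrb± a t (iter (eval f) k t) ⇔ (n ∣ k))
proposition2p6 f a t _ =
  Returns.returns⇔first-return∣ (sameOrbit-isEquivalence a) (eval f) (eval-sameOrbit a f)
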